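{- Let $D\in\mathbb{N}$ be a constant and $d\in\mathbb{N}$ with $3\le D\le d\le n$. There exist multisets $\gamma_1,\dots,\gamma_N$ of size $D$ with elements from $[n]$, with $N\le O_D\!\left(\frac{n^D}{d^{D-1}}\right)$ (the implied constant depending only on $D$), such that every multiset $\alpha$ of size $d$ with elements from $[n]$ contains some $\gamma_k$ as a sub-multiset.
   Context: A multiset over $[n]$ is identified with a vector in $\mathbb{N}^n$ of multiplicities; its size is the sum of multiplicities, and $\gamma$ is a sub-multiset of $\alpha$ if $\gamma_j\le\alpha_j$ for all $j$. -}

module Defs where

open import Data.Nat using (ℕ; zero; suc; _+_; _≤_)
open import Data.Fin using (Fin)
import Data.Fin as F

-- A multiset over [n] = {0,…,n-1} is its multiplicity vector in ℕ^n.
Multiset : ℕ → Set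
Multiset n = Fin n → ℕ

size : ∀ {n} → Multiset n → ℕ
size {zero}  m = 0
size {suc n} m = m F.zero + size (λ i → m (F.suc i))

_⊆ₘ_ : ∀ {n} → Multiset n → Multiset n → Set
γ ⊆ₘ α = ∀ j → γ j ≤ α j

{-# OPTIONS --safe #-}
module Submission where

-- Cut [0, n) into B = ⌊d/D⌋ consecutive blocks of width w = ⌊n/B⌋ + 1, so n ≤ Bw ≤ 2n and
-- d ≤ 2DB.  A multiset of size d > B(D-1) has mass at least D on some block (pigeonhole), hence
-- contains a D-multiset supported in that block.  The D-tuples inside single blocks give at most
-- B·w^D candidates, and B·w^D·d^(D-1) ≤ (2D)^(D-1)·(Bw)^D ≤ (2D)^(D-1)·2^D·n^D.

open import Defs
open import Data.Nat using (ℕ; _≤_; _*_; _^_; _∸_)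
open import Data.Product using (Σ; _×_; ∃-syntax)
open import Data.List using (List; length)
open import Data.List.Relation.Unary.All using (All)
open import Data.List.Relation.Unary.Any using (Any)
open import Relation.Binary.PropositionalEquality using (_≡_)

open import Data.Nat using (zero; suc; _+_; _<_; _≟_; _<?_; _≤?_; z≤n; s≤s; s≤s⁻¹; z<s; NonZero; >-nonZero; _/_; _%_)
open import Data.Nat.Properties
open import Data.Nat.DivMod using (m≡m%n+[m/n]*n; m%n<n; m/n*n≤m; m/n≤m; m≥n⇒m/n>0)
open import Data.Nat.Solver using (module +-*-Solver)
open +-*-Solver using (solve; _:+_; _:*_; _:=_; con)
open import Data.Fin using (toℕ)
import Data.Fin as Fin
open import Data.Bool using (true; false; if_then_else_)
open import Data.Product using (_,_)
open import Data.Vec using (Vec; []; _∷_; [_]; count)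
open import Data.Vec.Relation.Unary.All as Allᵛ using ([]; _∷_) renaming (All to Allᵛ)
open import Data.List using ([]; _∷_; map; filter; concatMap; cartesianProductWith; upTo)
import Data.List.Relation.Unary.All as All
open import Data.List.Relation.Unary.All.Properties using (map⁺; all-filter)
open import Data.List.Properties using (length-++; length-map; length-filter; length-upTo)
open import Data.List.Membership.Propositional using (_∈_; lose)
open import Data.List.Membership.Propositional.Properties
  using (∈-map⁺; ∈-filter⁺; ∈-concatMap⁺; ∈-cartesianProductWith⁺; ∈-upTo⁺)
open import Data.List.Relation.Unary.Any using (here; there)
open import Function using (_∘_)
open import Relation.Binary.PropositionalEquality using (refl; sym; trans; cong; cong₂; subst; _≢_; module ≡-Reasoning)
open import Relation.Nullary using (Dec; yes; no; does; contradiction)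
open import Relation.Nullary.Decidable using (dec-true; dec-false)

windowSum : ℕ → ℕ → (ℕ → ℕ) → ℕ
windowSum s zero    f = 0
windowSum s (suc w) f = f s + windowSum (suc s) w f

windowSum-shift : ∀ s w f → windowSum (suc s) w f ≡ windowSum s w (f ∘ suc)
windowSum-shift s zero    f = refl
windowSum-shift s (suc w) f = cong (f (suc s) +_) (windowSum-shift (suc s) w f)

windowSum-cong : ∀ s w {f g : ℕ → ℕ} → (∀ k → s ≤ k → f k ≡ g k) → windowSum s w f ≡ windowSum s w g
windowSum-cong s zero    f≗g = refl
windowSum-cong s (suc w) f≗g =
  cong₂ _+_ (f≗g s ≤-refl) (windowSum-cong (suc s) w (λ k s<k → f≗g k (<⇒≤ s<k)))

windowSum-split : ∀ s u v f → windowSum s (u + v) f ≡ windowSum s u f + windowSum (s + u) v f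
windowSum-split s zero    v f rewrite +-identityʳ s = refl
windowSum-split s (suc u) v f rewrite +-suc s u =
  trans (cong (f s +_) (windowSum-split (suc s) u v f)) (sym (+-assoc (f s) _ _))

windowSum-prefix : ∀ s f {u v} → u ≤ v → windowSum s u f ≤ windowSum s v f
windowSum-prefix s f {u} u≤v with o , refl ← m≤n⇒∃[o]m+o≡n u≤v =
  subst (windowSum s u f ≤_) (sym (windowSum-split s u o f)) (m≤m+n _ _)

windowSum-zero : ∀ s w → windowSum s w (λ _ → 0) ≡ 0
windowSum-zero s zero    = refl
windowSum-zero s (suc w) = windowSum-zero (suc s) w

windowSum-distrib-+ : ∀ s w f g → windowSum s w (λ k → f k + g k) ≡ windowSum s w f + windowSum s w g
windowSum-distrib-+ s zero    f g = refl
windowSum-distrib-+ s (suc w) f g = begin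
  (f s + g s) + windowSum (suc s) w (λ k → f k + g k)
    ≡⟨ cong ((f s + g s) +_) (windowSum-distrib-+ (suc s) w f g) ⟩
  (f s + g s) + (windowSum (suc s) w f + windowSum (suc s) w g)
    ≡⟨ solve 4 (λ a b c d → (a :+ b) :+ (c :+ d) := (a :+ c) :+ (b :+ d))
         refl (f s) (g s) (windowSum (suc s) w f) (windowSum (suc s) w g) ⟩
  (f s + windowSum (suc s) w f) + (g s + windowSum (suc s) w g) ∎
  where open ≡-Reasoning

-- Zero from n on, so that the last block may overrun [0, n).
extend : ∀ {n} → Multiset n → ℕ → ℕ
extend {zero}  α k       = 0
extend {suc n} α zero    = α Fin.zero
extend {suc n} α (suc k) = extend (α ∘ Fin.suc) k

extend-toℕ : ∀ {n} (α : Multiset n) j → extend α (toℕ j) ≡ α j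
extend-toℕ α Fin.zero    = refl
extend-toℕ α (Fin.suc j) = extend-toℕ (α ∘ Fin.suc) j

extend-≥ : ∀ {n} (α : Multiset n) {k} → n ≤ k → extend α k ≡ 0
extend-≥ {zero}  α n≤k           = refl
extend-≥ {suc n} α (s≤s n≤k) = extend-≥ (α ∘ Fin.suc) n≤k

size-extend : ∀ {n} (α : Multiset n) → size α ≡ windowSum 0 n (extend α)
size-extend {zero}  α = refl
size-extend {suc n} α =
  cong (α Fin.zero +_) (trans (size-extend (α ∘ Fin.suc)) (sym (windowSum-shift 0 n (extend α))))

size-∘toℕ : ∀ n (g : ℕ → ℕ) → size {n} (g ∘ toℕ) ≡ windowSum 0 n g
size-∘toℕ zero    g = refl
size-∘toℕ (suc n) g = cong (g 0 +_) (trans (size-∘toℕ n (g ∘ suc)) (sym (windowSum-shift 0 n g)))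

occ : ∀ {D} → Vec ℕ D → ℕ → ℕ
occ v k = count (k ≟_) v

occ-∷ : ∀ {D} x (v : Vec ℕ D) k → occ (x ∷ v) k ≡ occ [ x ] k + occ v k
occ-∷ x v k with does (k ≟ x)
... | true  = refl
... | false = refl

windowSum-occ-single : ∀ {n x} → x < n → windowSum 0 n (occ [ x ]) ≡ 1
windowSum-occ-single {suc n} {zero}  _ =
  cong suc (trans (windowSum-shift 0 n (occ [ 0 ])) (windowSum-zero 0 n))
windowSum-occ-single {suc n} {suc x} (s≤s x<n) =
  trans (windowSum-shift 0 n (occ [ suc x ])) (windowSum-occ-single x<n)

windowSum-occ : ∀ {n D} (v : Vec ℕ D) → Allᵛ (_< n) v → windowSum 0 n (occ v) ≡ D
windowSum-occ {n} []      []           = windowSum-zero 0 n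
windowSum-occ {n} (x ∷ v) (x<n ∷ v<n) = begin
  windowSum 0 n (occ (x ∷ v))                         ≡⟨ windowSum-cong 0 n (λ k _ → occ-∷ x v k) ⟩
  windowSum 0 n (λ k → occ [ x ] k + occ v k)         ≡⟨ windowSum-distrib-+ 0 n (occ [ x ]) (occ v) ⟩
  windowSum 0 n (occ [ x ]) + windowSum 0 n (occ v)   ≡⟨ cong₂ _+_ (windowSum-occ-single x<n) (windowSum-occ v v<n) ⟩
  suc _ ∎
  where open ≡-Reasoning

toMultiset : ∀ {n D} → Vec ℕ D → Multiset n
toMultiset v = occ v ∘ toℕ

size-toMultiset : ∀ {n D} (v : Vec ℕ D) → Allᵛ (_< n) v → size {n} (toMultiset v) ≡ D
size-toMultiset {n} v v<n = trans (size-∘toℕ n (occ v)) (windowSum-occ v v<n)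

occ-∷-self : ∀ {D} x (v : Vec ℕ D) → occ (x ∷ v) x ≡ suc (occ v x)
occ-∷-self x v rewrite dec-true (x ≟ x) refl = refl

occ-∷-other : ∀ {D} {x k} (v : Vec ℕ D) → k ≢ x → occ (x ∷ v) k ≡ occ v k
occ-∷-other {x = x} {k} v k≢x rewrite dec-false (k ≟ x) k≢x = refl

occ-≤-∷ : ∀ {D} x (v : Vec ℕ D) k → occ v k ≤ occ (x ∷ v) k
occ-≤-∷ x v k with does (k ≟ x)
... | true  = n≤1+n _
... | false = ≤-refl

occ-≤⇒positive : ∀ {D} (v : Vec ℕ D) {f : ℕ → ℕ} → (∀ k → occ v k ≤ f k) → Allᵛ (λ x → 0 < f x) v
occ-≤⇒positive []      occ≤f = []
occ-≤⇒positive (x ∷ v) occ≤f =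
  ≤-trans (s≤s z≤n) (subst (_≤ _) (occ-∷-self x v) (occ≤f x))
  ∷ occ-≤⇒positive v (λ k → ≤-trans (occ-≤-∷ x v k) (occ≤f k))

range : ℕ → ℕ → List ℕ
range s zero    = []
range s (suc w) = s ∷ range (suc s) w

length-range : ∀ s w → length (range s w) ≡ w
length-range s zero    = refl
length-range s (suc w) = cong suc (length-range (suc s) w)

_[_]≔_ : (ℕ → ℕ) → ℕ → ℕ → ℕ → ℕ
(f [ s ]≔ m) k = if does (k ≟ s) then m else f k

[]≔-self : ∀ f s m → (f [ s ]≔ m) s ≡ m
[]≔-self f s m rewrite dec-true (s ≟ s) refl = refl

[]≔-other : ∀ f {s k} m → k ≢ s → (f [ s ]≔ m) k ≡ f k
[]≔-other f {s} {k} m k≢s rewrite dec-false (k ≟ s) k≢s = refl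

occ-∷-≤ : ∀ {D} {f : ℕ → ℕ} {s m} (v : Vec ℕ D) → f s ≡ suc m →
          (∀ k → occ v k ≤ (f [ s ]≔ m) k) → ∀ k → occ (s ∷ v) k ≤ f k
occ-∷-≤ {f = f} {s} {m} v fs≡1+m occ≤f′ k with k ≟ s
... | yes refl = begin
  occ (k ∷ v) k          ≡⟨ occ-∷-self k v ⟩
  suc (occ v k)          ≤⟨ s≤s (occ≤f′ k) ⟩
  suc ((f [ k ]≔ m) k)   ≡⟨ cong suc ([]≔-self f k m) ⟩
  suc m                  ≡⟨ sym fs≡1+m ⟩
  f k ∎
  where open ≤-Reasoning
... | no k≢s = begin
  occ (s ∷ v) k          ≡⟨ occ-∷-other v k≢s ⟩
  occ v k                ≤⟨ occ≤f′ k ⟩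
  (f [ s ]≔ m) k         ≡⟨ []≔-other f m k≢s ⟩
  f k ∎
  where open ≤-Reasoning

-- Either the rest of the window already has mass D, or its first point s is taken once and its
-- multiplicity in f lowered by one.
extract : ∀ D s w (f : ℕ → ℕ) → D ≤ windowSum s w f →
          Σ (Vec ℕ D) λ v → Allᵛ (_∈ range s w) v × (∀ k → occ v k ≤ f k)
extract zero    s w       f _ = [] , [] , λ _ → z≤n
extract (suc D) s (suc w) f D<Σ with suc D ≤? windowSum (suc s) w f
... | yes D<Σtail =
  let v , v∈ , v≤f = extract (suc D) (suc s) w f D<Σtail
  in  v , Allᵛ.map there v∈ , v≤f
... | no D≮Σtail with f s in fs≡
...   | zero  = contradiction D<Σ D≮Σtail
...   | suc m =
  let v , v∈ , v≤f′ = extract D s (suc w) (f [ s ]≔ m) D≤Σf′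
  in  s ∷ v , here refl ∷ v∈ , occ-∷-≤ v fs≡ v≤f′
  where
  D≤Σf′ : D ≤ windowSum s (suc w) (f [ s ]≔ m)
  D≤Σf′ = subst (D ≤_)
    (sym (cong₂ _+_ ([]≔-self f s m)
      (windowSum-cong (suc s) w (λ k s<k → []≔-other f m (λ k≡s → <-irrefl (sym k≡s) s<k)))))
    (s≤s⁻¹ D<Σ)

length-cartesianProductWith : ∀ {A B C : Set} (f : A → B → C) xs ys →
  length (cartesianProductWith f xs ys) ≡ length xs * length ys
length-cartesianProductWith f []       ys = refl
length-cartesianProductWith f (x ∷ xs) ys =
  trans (length-++ (map (f x) ys)) (cong₂ _+_ (length-map (f x) ys) (length-cartesianProductWith f xs ys))

length-concatMap-const : ∀ {A B : Set} (f : A → List B) {c} → (∀ x → length (f x) ≡ c) →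
  ∀ xs → length (concatMap f xs) ≡ length xs * c
length-concatMap-const f lf≡c []       = refl
length-concatMap-const f lf≡c (x ∷ xs) =
  trans (length-++ (f x)) (cong₂ _+_ (lf≡c x) (length-concatMap-const f lf≡c xs))

tuples : ∀ {A : Set} → List A → (D : ℕ) → List (Vec A D)
tuples xs zero    = [] ∷ []
tuples xs (suc D) = cartesianProductWith _∷_ xs (tuples xs D)

length-tuples : ∀ {A : Set} (xs : List A) D → length (tuples xs D) ≡ length xs ^ D
length-tuples xs zero    = refl
length-tuples xs (suc D) =
  trans (length-cartesianProductWith _∷_ xs (tuples xs D)) (cong (length xs *_) (length-tuples xs D))

∈-tuples⁺ : ∀ {A : Set} {xs : List A} {D} {v : Vec A D} → Allᵛ (_∈ xs) v → v ∈ tuples xs D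
∈-tuples⁺ []          = here refl
∈-tuples⁺ (x∈ ∷ v∈) = ∈-cartesianProductWith⁺ _∷_ x∈ (∈-tuples⁺ v∈)

blockTuples : (w D B : ℕ) → List (Vec ℕ D)
blockTuples w D B = concatMap (λ b → tuples (range (b * w) w) D) (upTo B)

length-blockTuples : ∀ w D B → length (blockTuples w D B) ≡ B * w ^ D
length-blockTuples w D B = begin
  length (blockTuples w D B)  ≡⟨ length-concatMap-const _ length-block (upTo B) ⟩
  length (upTo B) * w ^ D     ≡⟨ cong (_* w ^ D) (length-upTo B) ⟩
  B * w ^ D ∎
  where
  open ≡-Reasoning
  length-block : ∀ b → length (tuples (range (b * w) w) D) ≡ w ^ D
  length-block b = trans (length-tuples (range (b * w) w) D) (cong (_^ D) (length-range (b * w) w))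

pigeonhole : ∀ K w B s f → B * K < windowSum s (B * w) f →
             ∃[ b ] (b < B × K < windowSum (s + b * w) w f)
pigeonhole K w (suc B) s f BK<Σ with K <? windowSum s w f
... | yes K<Σ = 0 , z<s , subst (λ t → K < windowSum t w f) (sym (+-identityʳ s)) K<Σ
... | no K≮Σ =
  let b , b<B , K<Σb = pigeonhole K w B (s + w) f BK<Σrest
  in  suc b , s≤s b<B , subst (λ t → K < windowSum t w f) (+-assoc s w (b * w)) K<Σb
  where
  BK<Σrest : B * K < windowSum (s + w) (B * w) f
  BK<Σrest = +-cancelˡ-< K _ _ (begin-strict
    K + B * K                                           <⟨ BK<Σ ⟩
    windowSum s (w + B * w) f                           ≡⟨ windowSum-split s w (B * w) f ⟩
    windowSum s w f + windowSum (s + w) (B * w) f       ≤⟨ +-monoˡ-≤ _ (≮⇒≥ K≮Σ) ⟩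
    K + windowSum (s + w) (B * w) f ∎)
    where open ≤-Reasoning

below? : ∀ n {D} (v : Vec ℕ D) → Dec (Allᵛ (_< n) v)
below? n = Allᵛ.all? (_<? n)

candidates : (n w D B : ℕ) → List (Multiset n)
candidates n w D B = map toMultiset (filter (below? n) (blockTuples w D B))

size-candidates : ∀ n w D B → All (λ γ → size γ ≡ D) (candidates n w D B)
size-candidates n w D B =
  map⁺ (All.map (λ {v} → size-toMultiset v) (all-filter (below? n) (blockTuples w D B)))

length-candidates : ∀ n w D B → length (candidates n w D B) ≤ B * w ^ D
length-candidates n w D B = begin
  length (candidates n w D B)                     ≡⟨ length-map toMultiset (filter (below? n) (blockTuples w D B)) ⟩
  length (filter (below? n) (blockTuples w D B))  ≤⟨ length-filter (below? n) (blockTuples w D B) ⟩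
  length (blockTuples w D B)                      ≡⟨ length-blockTuples w D B ⟩
  B * w ^ D ∎
  where open ≤-Reasoning

occ-≤-extend⇒below : ∀ {n D} (α : Multiset n) (v : Vec ℕ D) → (∀ k → occ v k ≤ extend α k) → Allᵛ (_< n) v
occ-≤-extend⇒below α v v≤α =
  Allᵛ.map (λ 0<αx → ≰⇒> (λ n≤x → <-irrefl (sym (extend-≥ α n≤x)) 0<αx)) (occ-≤⇒positive v v≤α)

occ-≤-extend⇒⊆ₘ : ∀ {n D} (α : Multiset n) (v : Vec ℕ D) → (∀ k → occ v k ≤ extend α k) → toMultiset v ⊆ₘ α
occ-≤-extend⇒⊆ₘ α v v≤α j = subst (occ v (toℕ j) ≤_) (extend-toℕ α j) (v≤α (toℕ j))

candidates-cover : ∀ {n} K w B → n ≤ B * w → (α : Multiset n) → B * K < size α →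
                   Any (_⊆ₘ α) (candidates n w (suc K) B)
candidates-cover {n} K w B n≤Bw α BK<|α| =
  let b , b<B , K<Σb  = pigeonhole K w B 0 (extend α) BK<Σ
      v , v∈b , v≤α   = extract (suc K) (b * w) w (extend α) K<Σb
      v∈blocks        = ∈-concatMap⁺ _ (lose (∈-upTo⁺ b<B) (∈-tuples⁺ v∈b))
  in  lose (∈-map⁺ toMultiset (∈-filter⁺ (below? n) v∈blocks (occ-≤-extend⇒below α v v≤α)))
           (occ-≤-extend⇒⊆ₘ α v v≤α)
  where
  BK<Σ : B * K < windowSum 0 (B * w) (extend α)
  BK<Σ = ≤-trans BK<|α| (≤-trans (≤-reflexive (size-extend α)) (windowSum-prefix 0 (extend α) n≤Bw))

^-distribʳ-* : ∀ m n o → (m * n) ^ o ≡ m ^ o * n ^ o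
^-distribʳ-* m n zero    = refl
^-distribʳ-* m n (suc o) = begin
  m * n * (m * n) ^ o      ≡⟨ cong (m * n *_) (^-distribʳ-* m n o) ⟩
  m * n * (m ^ o * n ^ o)  ≡⟨ solve 4 (λ m n x y → m :* n :* (x :* y) := m :* x :* (n :* y)) refl m n (m ^ o) (n ^ o) ⟩
  m * m ^ o * (n * n ^ o)  ∎
  where open ≡-Reasoning

m≤n*[1+m/n] : ∀ m n .{{_ : NonZero n}} → m ≤ n * suc (m / n)
m≤n*[1+m/n] m n = begin
  m                    ≡⟨ m≡m%n+[m/n]*n m n ⟩
  m % n + m / n * n    ≤⟨ +-monoˡ-≤ _ (<⇒≤ (m%n<n m n)) ⟩
  n + m / n * n        ≡⟨ cong (n +_) (*-comm (m / n) n) ⟩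
  n + n * (m / n)      ≡⟨ sym (*-suc n (m / n)) ⟩
  n * suc (m / n)      ∎
  where open ≤-Reasoning

n*[1+m/n]≤2m : ∀ m n .{{_ : NonZero n}} → n ≤ m → n * suc (m / n) ≤ 2 * m
n*[1+m/n]≤2m m n n≤m = begin
  n * suc (m / n)      ≡⟨ *-suc n (m / n) ⟩
  n + n * (m / n)      ≡⟨ cong (n +_) (*-comm n (m / n)) ⟩
  n + m / n * n        ≤⟨ +-mono-≤ n≤m (m/n*n≤m m n) ⟩
  m + m                ≡⟨ cong (m +_) (sym (+-identityʳ m)) ⟩
  2 * m                ∎
  where open ≤-Reasoning

m≤2n*[m/n] : ∀ m n .{{_ : NonZero n}} → n ≤ m → m ≤ 2 * n * (m / n)
m≤2n*[m/n] m n n≤m = begin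
  m                    ≡⟨ m≡m%n+[m/n]*n m n ⟩
  m % n + m / n * n    ≤⟨ +-monoˡ-≤ _ (<⇒≤ (m%n<n m n)) ⟩
  n + m / n * n        ≤⟨ +-monoˡ-≤ _ (m≤m*n n (m / n) {{>-nonZero (m≥n⇒m/n>0 n≤m)}}) ⟩
  n * (m / n) + m / n * n  ≡⟨ solve 2 (λ n q → n :* q :+ q :* n := con 2 :* n :* q) refl n (m / n) ⟩
  2 * n * (m / n)      ∎
  where open ≤-Reasoning

m/[1+k]*k<m : ∀ m k → suc k ≤ m → m / suc k * k < m
m/[1+k]*k<m m k 1+k≤m = begin-strict
  m / suc k * k        <⟨ *-monoʳ-< (m / suc k) {{>-nonZero (m≥n⇒m/n>0 1+k≤m)}} (n<1+n k) ⟩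
  m / suc k * suc k    ≤⟨ m/n*n≤m m (suc k) ⟩
  m                    ∎
  where open ≤-Reasoning

candidates-count-bound : ∀ K c B w d n → d ≤ c * B → B * w ≤ 2 * n →
                   B * w ^ suc K * d ^ K ≤ c ^ K * 2 ^ suc K * n ^ suc K
candidates-count-bound K c B w d n d≤cB Bw≤2n = begin
  B * w ^ suc K * d ^ K                ≤⟨ *-monoʳ-≤ (B * w ^ suc K) (^-monoˡ-≤ K d≤cB) ⟩
  B * w ^ suc K * (c * B) ^ K          ≡⟨ cong (B * w ^ suc K *_) (^-distribʳ-* c B K) ⟩
  B * (w * w ^ K) * (c ^ K * B ^ K)    ≡⟨ solve 5 (λ b w wᴷ cᴷ bᴷ → b :* (w :* wᴷ) :* (cᴷ :* bᴷ) := cᴷ :* (b :* w :* (bᴷ :* wᴷ)))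
                                            refl B w (w ^ K) (c ^ K) (B ^ K) ⟩
  c ^ K * (B * w * (B ^ K * w ^ K))    ≡⟨ cong (λ t → c ^ K * (B * w * t)) (sym (^-distribʳ-* B w K)) ⟩
  c ^ K * (B * w) ^ suc K              ≤⟨ *-monoʳ-≤ (c ^ K) (^-monoˡ-≤ (suc K) Bw≤2n) ⟩
  c ^ K * (2 * n) ^ suc K              ≡⟨ cong (c ^ K *_) (^-distribʳ-* 2 n (suc K)) ⟩
  c ^ K * (2 ^ suc K * n ^ suc K)      ≡⟨ sym (*-assoc (c ^ K) _ _) ⟩
  c ^ K * 2 ^ suc K * n ^ suc K        ∎
  where open ≤-Reasoning

blockParameters : ∀ K {d n} → suc K ≤ d → d ≤ n →
  ∃[ B ] ∃[ w ] (n ≤ B * w × B * K < d × B * w ^ suc K * d ^ K ≤ (2 * suc K) ^ K * 2 ^ suc K * n ^ suc K)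
blockParameters K {d} {n} 1+K≤d d≤n =
  B , suc (n / B) , m≤n*[1+m/n] n B , m/[1+k]*k<m d K 1+K≤d ,
  candidates-count-bound K (2 * suc K) B (suc (n / B)) d n (m≤2n*[m/n] d (suc K) 1+K≤d)
    (n*[1+m/n]≤2m n B (≤-trans (m/n≤m d (suc K)) d≤n))
  where
  B : ℕ
  B = d / suc K
  instance
    B-nonZero : NonZero B
    B-nonZero = >-nonZero (m≥n⇒m/n>0 1+K≤d)

lemma3p16 : (D : ℕ) → 3 ≤ D →
    ∃[ C ] ((d n : ℕ) → D ≤ d → d ≤ n →
      ∃[ γs ] (All (λ γ → size {n} γ ≡ D) γs
        × length γs * d ^ (D ∸ 1) ≤ C * n ^ D
        × ((α : Multiset n) → size α ≡ d → Any (λ γ → γ ⊆ₘ α) γs)))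
lemma3p16 (suc K) _ = (2 * suc K) ^ K * 2 ^ suc K , λ d n 1+K≤d d≤n →
  let B , w , n≤Bw , BK<d , count-bound = blockParameters K 1+K≤d d≤n
  in  candidates n w (suc K) B ,
      size-candidates n w (suc K) B ,
      ≤-trans (*-monoˡ-≤ (d ^ K) (length-candidates n w (suc K) B)) count-bound ,
      λ α |α|≡d → candidates-cover K w B n≤Bw α (subst (B * K <_) (sym |α|≡d) BK<d)
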